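{- Let $(t_1,\ldots,t_{n+1})$ be a finite tournament sequence and suppose that for some integers $k\geq 1$ (with $n-k\geq 1$) and $c$ we have $$t_{n+1}=t_n+t_{n-1}+\cdots+t_{n-k+1}+c \quad\text{and}\quad t_n=t_{n-1}+t_{n-2}+\cdots+t_{n-k}+c.$$ Let $(m_1,\ldots,m_{n+1})=\phi(t_1,\ldots,t_{n+1})$. Then $m_{n+1}=m_n+m_{n-1}+\cdots+m_{n-k+1}+m_{n-k}$.
   Context: A tournament sequence is an increasing sequence of positive integers with $t_1=1$ and $t_i<t_{i+1}\leq 2t_i$. For an integer sequence $A$, $r(A)$ is the set of subset sums (by index, including $0$) of its terms and $ur(A)$ the set of integers that are such a sum for exactly one set of indices. A Meeussen sequence (finite) is an initial segment of an infinite sequence of positive integers $(m_1,m_2,\ldots)$ with $m_1=1$, $m_i<m_{i+1}$, all nonnegative integers in $r(M)$ and each $m_i-1\in ur(M)$. Both kinds of finite sequences form rooted trees (root $(1)$, parent of $(s_1,\ldots,s_n)$ is $(s_1,\ldots,s_{n-1})$), and $\phi$ denotes the unique rooted-tree isomorphism from the tree of tournament sequences to the tree of Meeussen sequences (it preserves length). -}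

module Defs where

open import Data.Nat using (ℕ; zero; suc; _+_; _*_; _∸_; _≤_; _<_)
open import Data.List using (List; []; _∷_; length; map; _∷ʳ_; applyUpTo)
open import Data.Nat.ListAction using (sum)
open import Data.List.Relation.Unary.AllPairs using (AllPairs)
open import Data.Product using (Σ; ∃; _×_; proj₁)
open import Data.Empty using (⊥)
open import Relation.Binary.PropositionalEquality using (_≡_)

-- at xs i = x_i (1-based); 0 outside the range 1..length xs.
at : List ℕ → ℕ → ℕ
at []       _             = 0
at (x ∷ xs) zero          = 0
at (x ∷ xs) (suc zero)    = x
at (x ∷ xs) (suc (suc i)) = at xs (suc i)

sumFrom : (ℕ → ℕ) → ℕ → ℕ → ℕ
sumFrom f a zero    = 0
sumFrom f a (suc l) = f a + sumFrom f (suc a) l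

-- TourChain p xs : the list xs continues a tournament sequence whose last term is p.
data TourChain : ℕ → List ℕ → Set where
  []  : ∀ {p} → TourChain p []
  _∷_ : ∀ {p x xs} → (p < x × x ≤ 2 * p) → TourChain x xs → TourChain p (x ∷ xs)

IsTournament : List ℕ → Set
IsTournament []       = ⊥
IsTournament (x ∷ xs) = x ≡ 1 × TourChain x xs

-- An infinite sequence is m : ℕ → ℕ with m 0 = m_1,
-- m 1 = m_2, ... (0-based internally).  A finite set of indices is
-- represented canonically by a strictly increasing list of indices.

IsSubsetSumRep : (ℕ → ℕ) → List ℕ → ℕ → Set
IsSubsetSumRep m S n = AllPairs _<_ S × sum (map m S) ≡ n

InR : (ℕ → ℕ) → ℕ → Set
InR m n = ∃ λ S → IsSubsetSumRep m S n

InUR : (ℕ → ℕ) → ℕ → Set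
InUR m n = ∃ λ S → IsSubsetSumRep m S n × (∀ S′ → IsSubsetSumRep m S′ n → S′ ≡ S)

IsInfiniteMeeussen : (ℕ → ℕ) → Set
IsInfiniteMeeussen m =
  m 0 ≡ 1
  × (∀ i → m i < m (suc i))
  × (∀ n → InR m n)
  × (∀ i → InUR m (m i ∸ 1))

IsMeeussen : List ℕ → Set
IsMeeussen M = 1 ≤ length M × ∃ λ m → IsInfiniteMeeussen m × M ≡ applyUpTo m (length M)

-- The two rooted trees: nodes are the finite sequences, root (1),
-- parent of (s_1..s_n) is (s_1..s_{n-1}), i.e. b is a child of a iff b = a ++ [x].

TSeq : Set
TSeq = Σ (List ℕ) IsTournament

MSeq : Set
MSeq = Σ (List ℕ) IsMeeussen

IsChild : List ℕ → List ℕ → Set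
IsChild a b = ∃ λ x → b ≡ a ∷ʳ x

-- φ is an isomorphism of rooted trees (nodes compared by their underlying sequences)
record IsRootedTreeIso (φ : TSeq → MSeq) : Set where
  field
    well-defined : ∀ s s′ → proj₁ s ≡ proj₁ s′ → proj₁ (φ s) ≡ proj₁ (φ s′)
    injective    : ∀ s s′ → proj₁ (φ s) ≡ proj₁ (φ s′) → proj₁ s ≡ proj₁ s′
    surjective   : ∀ (M : MSeq) → ∃ λ s → proj₁ (φ s) ≡ proj₁ M
    root         : ∀ s → proj₁ s ≡ 1 ∷ [] → proj₁ (φ s) ≡ 1 ∷ []
    child→       : ∀ s s′ → IsChild (proj₁ s) (proj₁ s′) → IsChild (proj₁ (φ s)) (proj₁ (φ s′))
    child←       : ∀ s s′ → IsChild (proj₁ (φ s)) (proj₁ (φ s′)) → IsChild (proj₁ s) (proj₁ s′)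

module Submission where

-- A tournament node has as many children as its last entry, and a Meeussen node N has one
-- child x for each x ∸ 1 ∈ [last N, sum N] that is a subset sum of N in exactly one way.  So
-- the tree isomorphism turns t_i into the number c_i of such values for (m_1, …, m_i).
-- Let U(y) be the number of representations of y by (m_1, …, m_n) and S_i = m_1 + ⋯ + m_i.
-- U is symmetric about S_n / 2, and (m_1, …, m_i) being complete forces two representations
-- of every y ∈ [m_i, S_(i-1)].  Hence among the y with U(y) = 1 there are 2c_n up to S_n,
-- c_(j+1) up to S_j (j < n) and c_(n+1) below m_(n+1).  The hypotheses give
-- t_(n+1) + t_(j+1) = 2t_n for j = n - k - 1, so, mirroring [0, S_j] to the top of [0, S_n],
-- there are as many such y below S_n - S_j as below m_(n+1).  U equals 1 just below both
-- bounds (at S_n - S_j - 1, the mirror of S_j + 1 < m_(j+2)), so m_(n+1) = S_n - S_j.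

open import Defs

-- ℕ's operators are opened only inside this anonymous module, leaving _+_ and +_ free for ℤ
-- in the statement of proposition2.
module _ where
  open import Data.Nat using (ℕ; zero; suc; pred; _+_; _*_; _∸_; _^_; _≤_; _<_; z≤n; s≤s; z<s; _≤?_; _<?_; _≟_)
  open import Data.Nat.Properties
  open import Data.Nat.ListAction using (sum)
  open import Data.Nat.ListAction.Properties using (sum-++)
  open import Data.Nat.Tactic.RingSolver using (solve-∀)
  open import Data.Integer as ℤ using (ℤ)
  import Data.Integer.Properties as ℤ
  open import Data.Fin using (Fin; zero; suc; toℕ; fromℕ<)
  import Data.Fin.Properties as Fin
  open import Data.List using (List; []; _∷_; _∷ʳ_; length; map; applyUpTo; take)
  open import Data.List.Properties using (∷-injectiveʳ; applyUpTo-∷ʳ; ∷ʳ-injective; ∷ʳ-injectiveʳ; length-++; take-all)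
  open import Data.List.Relation.Unary.All as All using (All; []; _∷_)
  open import Data.List.Relation.Unary.AllPairs using ([]; _∷_)
  open import Data.Product using (∃; _×_; _,_; proj₁; proj₂)
  open import Data.Sum using (inj₁; inj₂)
  open import Function using (_∘_; case_of_)
  open import Function.Definitions using (Injective)
  open import Relation.Binary.Core using (_Preserves_⟶_)
  open import Relation.Binary.Definitions using (tri<; tri≈; tri>)
  open import Relation.Nullary using (¬_; yes; no; contradiction)
  open import Relation.Binary.PropositionalEquality

  data Offset (a : ℕ) : ℕ → Set where
    below : ∀ {y} → y < a → Offset a y
    above : ∀ z → Offset a (a + z)

  offset : ∀ a y → Offset a y
  offset zero    y       = above y
  offset (suc a) zero    = below z<s
  offset (suc a) (suc y) with offset a y
  ... | below y<a = below (s≤s y<a)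
  ... | above z   = above z

  <-cancel-+≡ : ∀ {u v a s} → u + v ≡ a + s → v < a → s < u
  <-cancel-+≡ {u} {v} {a} {s} eq v<a = +-cancelʳ-< a s u (begin-strict
    s + a ≡⟨ +-comm s a ⟩
    a + s ≡⟨ eq ⟨
    u + v <⟨ +-monoʳ-< u v<a ⟩
    u + a ∎)
    where open ≤-Reasoning

  +≢1 : ∀ {m n} → 1 ≤ m → 1 ≤ n → m + n ≢ 1
  +≢1 {suc m} {suc n} _ _ eq = 0≢1+n (sym (suc-injective (trans (sym (+-suc (suc m) n)) eq)))

  +≡1⇒≡1ˡ : ∀ {m n} → m + n ≡ 1 → 1 ≤ m → m ≡ 1
  +≡1⇒≡1ˡ {m} {zero}  eq _   = trans (sym (+-identityʳ m)) eq
  +≡1⇒≡1ˡ {m} {suc n} eq 1≤m = contradiction eq (+≢1 1≤m (s≤s z≤n))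

  +≡1⇒≡1ʳ : ∀ {m n} → m + n ≡ 1 → 1 ≤ n → n ≡ 1
  +≡1⇒≡1ʳ {m} eq = +≡1⇒≡1ˡ (trans (+-comm _ m) eq)

  1≤+⇒1≤ʳ : ∀ {m n} → 1 ≤ m + n → ¬ 1 ≤ m → 1 ≤ n
  1≤+⇒1≤ʳ {zero}  pos _   = pos
  1≤+⇒1≤ʳ {suc m} _   ¬pos = contradiction (s≤s z≤n) ¬pos

  2≤+⇒1≤both : ∀ {m n} → 2 ≤ m + n → ¬ 2 ≤ m → ¬ 2 ≤ n → 1 ≤ m × 1 ≤ n
  2≤+⇒1≤both {zero}                two      _    ¬two = contradiction two ¬two
  2≤+⇒1≤both {suc zero}    {zero}  (s≤s ()) _    _
  2≤+⇒1≤both {suc zero}    {suc n} _        _    _    = s≤s z≤n , s≤s z≤n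
  2≤+⇒1≤both {suc (suc m)}         _        ¬two _    = contradiction (s≤s (s≤s z≤n)) ¬two

  ∸1< : ∀ {x} → 1 ≤ x → x ∸ 1 < x
  ∸1< {suc x} _ = ≤-refl

  m∸n>0⇒m∸n+n≡m : ∀ m n → 1 ≤ m ∸ n → m ∸ n + n ≡ m
  m∸n>0⇒m∸n+n≡m m n 1≤m∸n = m∸n+n≡m {m} {n} (<⇒≤ (m∸n≢0⇒n<m (>⇒≢ 1≤m∸n)))

  m<n⇒n+m<2*n : ∀ {m n} → m < n → n + m < 2 * n
  m<n⇒n+m<2*n {m} {n} m<n = begin-strict
    n + m  <⟨ +-monoʳ-< n m<n ⟩
    n + n  ≡⟨ cong (n +_) (+-identityʳ n) ⟨
    2 * n  ∎
    where open ≤-Reasoning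

  n+m<2*n⇒m<n : ∀ {m n} → n + m < 2 * n → m < n
  n+m<2*n⇒m<n {m} {n} n+m<2n = +-cancelˡ-< n m n (<-≤-trans n+m<2n (≤-reflexive (cong (n +_) (+-identityʳ n))))

  suc-mono⇒mono : ∀ (f : ℕ → ℕ) → (∀ n → f n ≤ f (suc n)) → f Preserves _≤_ ⟶ _≤_
  suc-mono⇒mono f step {i} {zero}  z≤n   = ≤-refl
  suc-mono⇒mono f step {i} {suc j} i≤1+j with m≤n⇒m<n∨m≡n i≤1+j
  ... | inj₁ (s≤s i≤j) = ≤-trans (suc-mono⇒mono f step i≤j) (step j)
  ... | inj₂ refl      = ≤-refl

  suc-stable⇒stable : ∀ (f : ℕ → ℕ) {i} → (∀ n → i ≤ n → f (suc n) ≡ f n) → ∀ {j} → i ≤ j → f j ≡ f i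
  suc-stable⇒stable f step {zero}  z≤n   = refl
  suc-stable⇒stable f step {suc j} i≤1+j with m≤n⇒m<n∨m≡n i≤1+j
  ... | inj₁ (s≤s i≤j) = trans (step j i≤j) (suc-stable⇒stable f step i≤j)
  ... | inj₂ refl      = refl

  sum-∷ʳ : ∀ N x → sum (N ∷ʳ x) ≡ sum N + x
  sum-∷ʳ N x = trans (sum-++ N (x ∷ [])) (cong (sum N +_) (+-identityʳ x))

  length-∷ʳ : ∀ (N : List ℕ) x → length (N ∷ʳ x) ≡ suc (length N)
  length-∷ʳ N x = trans (length-++ N) (+-comm (length N) 1)

  lastOr : ℕ → List ℕ → ℕ
  lastOr d []       = d
  lastOr d (x ∷ xs) = lastOr x xs

  lastOr-∷ʳ : ∀ d N x → lastOr d (N ∷ʳ x) ≡ x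
  lastOr-∷ʳ d []      x = refl
  lastOr-∷ʳ d (a ∷ N) x = lastOr-∷ʳ a N x

  take-suc-at : ∀ (ys : List ℕ) {i} → i < length ys → take (suc i) ys ≡ take i ys ∷ʳ at ys (suc i)
  take-suc-at (y ∷ ys) {zero}  _         = refl
  take-suc-at (y ∷ ys) {suc i} (s≤s i<n) = cong (y ∷_) (take-suc-at ys i<n)

  take-∷ʳ : ∀ (N : List ℕ) y {i} → i ≤ length N → take i (N ∷ʳ y) ≡ take i N
  take-∷ʳ N       y {zero}  _         = refl
  take-∷ʳ (x ∷ N) y {suc i} (s≤s i≤n) = cong (x ∷_) (take-∷ʳ N y i≤n)

  lastOr-take : ∀ (ys : List ℕ) {i} → i < length ys → lastOr 0 (take (suc i) ys) ≡ at ys (suc i)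
  lastOr-take ys {i} i<n = trans (cong (lastOr 0) (take-suc-at ys i<n)) (lastOr-∷ʳ 0 (take i ys) (at ys (suc i)))

  sumFrom-cong : ∀ f g a b l → (∀ i → i < l → f (a + i) ≡ g (b + i)) → sumFrom f a l ≡ sumFrom g b l
  sumFrom-cong f g a b zero    _   = refl
  sumFrom-cong f g a b (suc l) f≡g = cong₂ _+_ head (sumFrom-cong f g (suc a) (suc b) l tail)
    where
    head : f a ≡ g b
    head = trans (cong f (sym (+-identityʳ a))) (trans (f≡g 0 z<s) (cong g (+-identityʳ b)))
    tail : ∀ i → i < l → f (suc a + i) ≡ g (suc b + i)
    tail i i<l = trans (cong f (sym (+-suc a i))) (trans (f≡g (suc i) (s≤s i<l)) (cong g (+-suc b i)))

  sumFrom-suc : ∀ f a l → sumFrom f a (suc l) ≡ sumFrom f a l + f (a + l)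
  sumFrom-suc f a zero    = trans (+-identityʳ (f a)) (cong f (sym (+-identityʳ a)))
  sumFrom-suc f a (suc l) = begin
    f a + sumFrom f (suc a) (suc l)              ≡⟨ cong (f a +_) (sumFrom-suc f (suc a) l) ⟩
    f a + (sumFrom f (suc a) l + f (suc a + l))  ≡⟨ cong (λ i → f a + (sumFrom f (suc a) l + f i)) (+-suc a l) ⟨
    f a + (sumFrom f (suc a) l + f (a + suc l))  ≡⟨ +-assoc (f a) _ _ ⟨
    f a + sumFrom f (suc a) l + f (a + suc l)    ∎
    where open ≡-Reasoning

  -- Subset-sum counts

  shift : (ℕ → ℕ) → ℕ → ℕ → ℕ
  shift h zero    y       = h y
  shift h (suc a) zero    = 0
  shift h (suc a) (suc y) = shift h a y

  shift-+ : ∀ h a z → shift h a (a + z) ≡ h z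
  shift-+ h zero    z = refl
  shift-+ h (suc a) z = shift-+ h a z

  shift-< : ∀ h {a y} → y < a → shift h a y ≡ 0
  shift-< h {suc a} {zero}  _         = refl
  shift-< h {suc a} {suc y} (s≤s y<a) = shift-< h y<a

  shift-≥ : ∀ h {a y} → a ≤ y → shift h a y ≡ h (y ∸ a)
  shift-≥ h {a} a≤y = trans (cong (shift h a) (sym (m+[n∸m]≡n a≤y))) (shift-+ h a _)

  shift-shift : ∀ h a b → shift (shift h b) a ≗ shift h (a + b)
  shift-shift h zero    b y       = refl
  shift-shift h (suc a) b zero    = refl
  shift-shift h (suc a) b (suc y) = shift-shift h a b y

  shift-distrib-+ : ∀ h g a → shift (λ z → h z + g z) a ≗ λ y → shift h a y + shift g a y
  shift-distrib-+ h g zero    y       = refl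
  shift-distrib-+ h g (suc a) zero    = refl
  shift-distrib-+ h g (suc a) (suc y) = shift-distrib-+ h g a y

  shift-cong : ∀ {h g} a → h ≗ g → shift h a ≗ shift g a
  shift-cong zero    h≗g y       = h≗g y
  shift-cong (suc a) h≗g zero    = refl
  shift-cong (suc a) h≗g (suc y) = shift-cong a h≗g y

  -- reps N y counts the index sets of N with sum y: y ∈ r(N) iff 1 ≤ reps N y, y ∈ ur(N) iff reps N y ≡ 1.
  reps : List ℕ → ℕ → ℕ
  reps []      zero    = 1
  reps []      (suc _) = 0
  reps (a ∷ N) y       = reps N y + shift (reps N) a y

  reps-beyond : ∀ N {y} → sum N < y → reps N y ≡ 0
  reps-beyond []      {suc y} _ = refl
  reps-beyond (a ∷ N) {y} a+ΣN<y with offset a y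
  ... | below y<a = cong₂ _+_ (reps-beyond N (≤-<-trans (m≤n+m _ a) a+ΣN<y)) (shift-< (reps N) y<a)
  ... | above z   = cong₂ _+_ (reps-beyond N (≤-<-trans (m≤n+m _ a) a+ΣN<y))
                              (trans (shift-+ (reps N) a z) (reps-beyond N (+-cancelˡ-< a _ _ a+ΣN<y)))

  reps-pos⇒≤sum : ∀ N {y} → 1 ≤ reps N y → y ≤ sum N
  reps-pos⇒≤sum N {y} pos with y ≤? sum N
  ... | yes y≤Σ = y≤Σ
  ... | no  y≰Σ = contradiction (subst (1 ≤_) (reps-beyond N (≰⇒> y≰Σ)) pos) λ ()

  reps-∷ʳ : ∀ N x y → reps (N ∷ʳ x) y ≡ reps N y + shift (reps N) x y
  reps-∷ʳ []      x y = refl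
  reps-∷ʳ (a ∷ N) x y =
    begin
      reps (N ∷ʳ x) y + shift (reps (N ∷ʳ x)) a y
    ≡⟨ cong₂ _+_ (reps-∷ʳ N x y) (trans (shift-cong a (reps-∷ʳ N x) y) (shift-distrib-+ _ _ a y)) ⟩
      (A + B) + (C + shift (shift (reps N) x) a y)
    ≡⟨ cong (λ t → (A + B) + (C + t)) (trans (shift-shift (reps N) a x y) (cong (λ t → shift (reps N) t y) (+-comm a x))) ⟩
      (A + B) + (C + shift (reps N) (x + a) y)
    ≡⟨ interchange A B C _ ⟩
      (A + C) + (B + shift (reps N) (x + a) y)
    ≡⟨ cong (λ t → (A + C) + (B + t)) (shift-shift (reps N) x a y) ⟨
      (A + C) + (B + shift (shift (reps N) a) x y)
    ≡⟨ cong ((A + C) +_) (shift-distrib-+ (reps N) (shift (reps N) a) x y) ⟨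
      reps (a ∷ N) y + shift (reps (a ∷ N)) x y
    ∎
    where
    open ≡-Reasoning
    A B C : ℕ
    A = reps N y
    B = shift (reps N) x y
    C = shift (reps N) a y
    interchange : ∀ a b c d → (a + b) + (c + d) ≡ (a + c) + (b + d)
    interchange = solve-∀

  reps-complement : ∀ N {u v} → u + v ≡ sum N → reps N u ≡ reps N v
  reps-complement []      {zero}  {zero} _ = refl
  reps-complement (a ∷ N) {u} {v} u+v≡ =
    begin
      reps N u + shift (reps N) a u ≡⟨ cong₂ _+_ (cross u+v≡) (sym (cross (trans (+-comm v u) u+v≡))) ⟩
      shift (reps N) a v + reps N v ≡⟨ +-comm (shift (reps N) a v) (reps N v) ⟩
      reps N v + shift (reps N) a v ∎
    where
    open ≡-Reasoning
    cross : ∀ {u v} → u + v ≡ a + sum N → reps N u ≡ shift (reps N) a v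
    cross {u} {v} eq with offset a v
    ... | below v<a = trans (reps-beyond N (<-cancel-+≡ eq v<a)) (sym (shift-< (reps N) v<a))
    ... | above z   = trans (reps-complement N (+-cancelˡ-≡ a _ _ (trans (swap a u z) eq))) (sym (shift-+ (reps N) a z))
      where
      swap : ∀ a u z → a + (u + z) ≡ u + (a + z)
      swap = solve-∀

  reps-sum : ∀ {N} → All (1 ≤_) N → reps N (sum N) ≡ 1
  reps-sum {[]}    []          = refl
  reps-sum {a ∷ N} (1≤a ∷ 1≤N) =
    cong₂ _+_ (reps-beyond N (m<n+m (sum N) 1≤a)) (trans (shift-+ (reps N) a (sum N)) (reps-sum 1≤N))

  isOne : ℕ → ℕ
  isOne 1 = 1
  isOne _ = 0

  ones : (ℕ → ℕ) → ℕ → ℕ → ℕ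
  ones h a zero    = 0
  ones h a (suc l) = isOne (h a) + ones h (suc a) l

  ones-++ : ∀ h a l₁ l₂ → ones h a (l₁ + l₂) ≡ ones h a l₁ + ones h (a + l₁) l₂
  ones-++ h a zero     l₂ = cong (λ b → ones h b l₂) (sym (+-identityʳ a))
  ones-++ h a (suc l₁) l₂ = trans (cong (isOne (h a) +_) (trans (ones-++ h (suc a) l₁ l₂)
                                    (cong (λ b → ones h (suc a) l₁ + ones h b l₂) (sym (+-suc a l₁)))))
                                  (sym (+-assoc (isOne (h a)) _ _))

  ones-suc : ∀ h a l → ones h a (suc l) ≡ ones h a l + isOne (h (a + l))
  ones-suc h a l = trans (cong (ones h a) (+-comm 1 l)) (trans (ones-++ h a l 1) (cong (ones h a l +_) (+-identityʳ _)))

  ones-mono : ∀ h a {l₁ l₂} → l₁ ≤ l₂ → ones h a l₁ ≤ ones h a l₂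
  ones-mono h a {l₁} l₁≤l₂ with m≤n⇒∃[o]m+o≡n l₁≤l₂
  ... | d , refl = ≤-trans (m≤m+n _ _) (≤-reflexive (sym (ones-++ h a l₁ d)))

  ones-cong : ∀ h g a b l → (∀ z → z < l → h (a + z) ≡ g (b + z)) → ones h a l ≡ ones g b l
  ones-cong h g a b zero    _   = refl
  ones-cong h g a b (suc l) h≡g = cong₂ _+_ (cong isOne head) (ones-cong h g (suc a) (suc b) l tail)
    where
    head : h a ≡ g b
    head = trans (cong h (sym (+-identityʳ a))) (trans (h≡g 0 z<s) (cong g (+-identityʳ b)))
    tail : ∀ z → z < l → h (suc a + z) ≡ g (suc b + z)
    tail z z<l = trans (cong h (sym (+-suc a z))) (trans (h≡g (suc z) (s≤s z<l)) (cong g (+-suc b z)))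

  ones-none : ∀ h a l → (∀ y → a ≤ y → y < a + l → h y ≢ 1) → ones h a l ≡ 0
  ones-none h a zero    _      = refl
  ones-none h a (suc l) no-one = cong₂ _+_ (isOne≡0 (no-one a ≤-refl (m<m+n a z<s)))
    (ones-none h (suc a) l (λ y a<y y<1+a+l → no-one y (<⇒≤ a<y) (<-≤-trans y<1+a+l (≤-reflexive (sym (+-suc a l))))))
    where
    isOne≡0 : ∀ {x} → x ≢ 1 → isOne x ≡ 0
    isOne≡0 {zero}        _   = refl
    isOne≡0 {suc zero}    x≢1 = contradiction refl x≢1
    isOne≡0 {suc (suc x)} _   = refl

  ones-reflect : ∀ h T → (∀ u v → u + v ≡ T → h u ≡ h v) →
                 ∀ l a b → a + l + b ≡ suc T → ones h a l ≡ ones h b l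
  ones-reflect h T h-sym zero    a b _ = refl
  ones-reflect h T h-sym (suc l) a b a+l+b≡ =
    begin
      isOne (h a) + ones h (suc a) l   ≡⟨ cong₂ _+_ (cong isOne (h-sym a (b + l) a+[b+l]≡T))
                                                   (ones-reflect h T h-sym l (suc a) b (trans (cong (_+ b) (sym (+-suc a l))) a+l+b≡)) ⟩
      isOne (h (b + l)) + ones h b l   ≡⟨ +-comm (isOne (h (b + l))) _ ⟩
      ones h b l + isOne (h (b + l))   ≡⟨ ones-suc h b l ⟨
      ones h b (suc l)                 ∎
    where
    open ≡-Reasoning
    a+[b+l]≡T : a + (b + l) ≡ T
    a+[b+l]≡T = cong pred (trans (rearrange a b l) a+l+b≡)
      where
      rearrange : ∀ a b l → suc (a + (b + l)) ≡ a + suc l + b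
      rearrange = solve-∀

  ones-strict : ∀ h a {x y} → x < y → h (a + y) ≡ 1 → ones h a (suc x) < ones h a (suc y)
  ones-strict h a {x} {y} x<y h[a+y]≡1 = begin-strict
    ones h a (suc x)              ≤⟨ ones-mono h a x<y ⟩
    ones h a y                    <⟨ m<m+n _ z<s ⟩
    ones h a y + 1                ≡⟨ cong (λ t → ones h a y + isOne t) h[a+y]≡1 ⟨
    ones h a y + isOne (h (a + y)) ≡⟨ ones-suc h a y ⟨
    ones h a (suc y)              ∎
    where open ≤-Reasoning

  ones-injective : ∀ h a {x y} → h (a + x) ≡ 1 → h (a + y) ≡ 1 → ones h a (suc x) ≡ ones h a (suc y) → x ≡ y
  ones-injective h a {x} {y} hx≡1 hy≡1 eq with <-cmp x y
  ... | tri< x<y _ _ = contradiction eq (<⇒≢ (ones-strict h a x<y hy≡1))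
  ... | tri≈ _ x≡y _ = x≡y
  ... | tri> _ _ y<x = contradiction eq (>⇒≢ (ones-strict h a y<x hx≡1))

  erase : ℕ → (ℕ → ℕ) → ℕ → ℕ
  erase x h y with y ≟ x
  ... | yes _ = 0
  ... | no  _ = h y

  erase-≡ : ∀ x h → erase x h x ≡ 0
  erase-≡ x h with x ≟ x
  ... | yes _   = refl
  ... | no  x≢x = contradiction refl x≢x

  erase-≢ : ∀ x h {y} → y ≢ x → erase x h y ≡ h y
  erase-≢ x h {y} y≢x with y ≟ x
  ... | yes y≡x = contradiction y≡x y≢x
  ... | no  _   = refl

  erase-one : ∀ x h {y} → erase x h y ≡ 1 → y ≢ x × h y ≡ 1
  erase-one x h {y} e with y ≟ x
  ... | yes _   = contradiction e 0≢1+n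
  ... | no  y≢x = y≢x , e

  ones-erase : ∀ h x a L → a ≤ x → x < a + L → h x ≡ 1 → ones h a L ≡ suc (ones (erase x h) a L)
  ones-erase h x a zero    a≤x x<a _ = contradiction (≤-trans x<a (≤-trans (≤-reflexive (+-identityʳ a)) a≤x)) (<-irrefl refl)
  ones-erase h x a (suc L) a≤x x<a+1+L hx≡1 with m≤n⇒m<n∨m≡n a≤x
  ... | inj₂ refl = trans (cong (λ t → isOne t + ones h (suc x) L) hx≡1)
                          (cong suc (trans (ones-cong h (erase x h) (suc x) (suc x) L λ z _ → sym (erase-≢ x h (m≢1+m+n x ∘ sym)))
                                           (cong (λ t → isOne t + ones (erase x h) (suc x) L) (sym (erase-≡ x h)))))
  ... | inj₁ a<x  = trans (cong₂ _+_ (cong isOne (sym (erase-≢ x h (<⇒≢ a<x))))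
                                     (ones-erase h x (suc a) L a<x (<-≤-trans x<a+1+L (≤-reflexive (+-suc a L))) hx≡1))
                          (+-suc _ _)

  ones-bijection : ∀ {l} h a L (F : Fin l → ℕ) → Injective _≡_ _≡_ F →
                   (∀ i → a ≤ F i × F i < a + L × h (F i) ≡ 1) →
                   (∀ y → a ≤ y → y < a + L → h y ≡ 1 → ∃ λ i → F i ≡ y) →
                   ones h a L ≡ l
  ones-bijection {zero}  h a L F _ _ onto = ones-none h a L λ y a≤y y<a+L hy≡1 → case onto y a≤y y<a+L hy≡1 of λ ()
  ones-bijection {suc l} h a L F F-inj into onto with into zero
  ... | a≤F₀ , F₀<a+L , hF₀≡1 =
    trans (ones-erase h (F zero) a L a≤F₀ F₀<a+L hF₀≡1)
          (cong suc (ones-bijection (erase (F zero) h) a L (F ∘ suc) (Fin.suc-injective ∘ F-inj) into′ onto′))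
    where
    F₀-fresh : ∀ i → F (suc i) ≢ F zero
    F₀-fresh i eq = case F-inj eq of λ ()
    into′ : ∀ i → a ≤ F (suc i) × F (suc i) < a + L × erase (F zero) h (F (suc i)) ≡ 1
    into′ i = proj₁ (into (suc i)) , proj₁ (proj₂ (into (suc i))) ,
              trans (erase-≢ (F zero) h (F₀-fresh i)) (proj₂ (proj₂ (into (suc i))))
    onto′ : ∀ y → a ≤ y → y < a + L → erase (F zero) h y ≡ 1 → ∃ λ i → F (suc i) ≡ y
    onto′ y a≤y y<a+L ey≡1 with erase-one (F zero) h ey≡1
    ... | y≢F₀ , hy≡1 with onto y a≤y y<a+L hy≡1
    ...   | zero  , refl = contradiction refl y≢F₀
    ...   | suc i , Fi≡y = i , Fi≡y

  -- Complete lists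

  -- Counts the y ∈ [last N, sum N] with reps N y ≡ 1, which are the x ∸ 1 for the children x of
  -- the Meeussen node N (meeussen-∷ʳ⁻, meeussen-∷ʳ⁺); the window may overshoot sum N harmlessly.
  branching : List ℕ → ℕ
  branching N = ones (reps N) (lastOr 0 N) (suc (sum N))

  Complete : List ℕ → Set
  Complete N = ∀ y → y ≤ sum N → 1 ≤ reps N y

  complete-∷ʳ : ∀ {N x} → Complete N → x ≤ suc (sum N) → Complete (N ∷ʳ x)
  complete-∷ʳ {N} {x} N-complete x≤1+ΣN y y≤Σ rewrite reps-∷ʳ N x y | sum-∷ʳ N x with offset x y
  ... | below y<x = ≤-trans (N-complete y (≤-pred (<-≤-trans y<x x≤1+ΣN))) (m≤m+n _ _)
  ... | above z   = ≤-trans (≤-trans (N-complete z z≤ΣN) (≤-reflexive (sym (shift-+ (reps N) x z)))) (m≤n+m _ _)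
    where
    z≤ΣN : z ≤ sum N
    z≤ΣN = +-cancelˡ-≤ x z (sum N) (≤-trans y≤Σ (≤-reflexive (+-comm (sum N) x)))

  reps-∷ʳ-≥2 : ∀ {N x y} → Complete N → x ≤ y → y ≤ sum N → 2 ≤ reps (N ∷ʳ x) y
  reps-∷ʳ-≥2 {N} {x} {y} N-complete x≤y y≤ΣN = begin
    2                                   ≤⟨ +-mono-≤ (N-complete y y≤ΣN) (N-complete (y ∸ x) (≤-trans (m∸n≤m y x) y≤ΣN)) ⟩
    reps N y + reps N (y ∸ x)           ≡⟨ cong (reps N y +_) (shift-≥ (reps N) x≤y) ⟨
    reps N y + shift (reps N) x y       ≡⟨ reps-∷ʳ N x y ⟨
    reps (N ∷ʳ x) y                     ∎
    where open ≤-Reasoning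

  ones-reps-beyond : ∀ N {a} l → sum N < a → ones (reps N) a l ≡ 0
  ones-reps-beyond N {a} l ΣN<a = ones-none (reps N) a l λ y a≤y _ reps≡1 →
    0≢1+n (trans (sym (reps-beyond N (<-≤-trans ΣN<a a≤y))) reps≡1)

  ones-reps-∷ʳ-gap : ∀ {N x g} → Complete N → x + g ≡ suc (sum N) → ones (reps (N ∷ʳ x)) x g ≡ 0
  ones-reps-∷ʳ-gap {N} {x} {g} N-complete x+g≡ = ones-none (reps (N ∷ʳ x)) x g λ y x≤y y<x+g →
    >⇒≢ (reps-∷ʳ-≥2 {N} N-complete x≤y (≤-pred (<-≤-trans y<x+g (≤-reflexive x+g≡))))

  branching-∷ʳ : ∀ {N x} → Complete N → x ≤ suc (sum N) → branching (N ∷ʳ x) ≡ ones (reps N) 0 x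
  branching-∷ʳ {N} {x} N-complete x≤1+ΣN with m≤n⇒∃[o]m+o≡n x≤1+ΣN
  ... | d , x+d≡ =
    begin
      branching (N ∷ʳ x)                                ≡⟨ cong₂ (λ a s → ones U a (suc s)) (lastOr-∷ʳ 0 N x) (sum-∷ʳ N x) ⟩
      ones U x (suc (sum N + x))                        ≡⟨ cong (λ s → ones U x (s + x)) x+d≡ ⟨
      ones U x (x + d + x)                              ≡⟨ cong (ones U x) (regroup x d) ⟩
      ones U x (d + (x + x))                            ≡⟨ ones-++ U x d (x + x) ⟩
      ones U x d + ones U (x + d) (x + x)               ≡⟨ cong₂ _+_ (ones-reps-∷ʳ-gap {N} {x} N-complete x+d≡) (ones-++ U (x + d) x x) ⟩
      ones U (x + d) x + ones U (x + d + x) x           ≡⟨ cong (ones U (x + d) x +_) (ones-reps-beyond (N ∷ʳ x) x ΣNx<) ⟩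
      ones U (x + d) x + 0                              ≡⟨ +-identityʳ _ ⟩
      ones U (x + d) x                                  ≡⟨ ones-cong U (reps N) (x + d) d x (λ z _ → U[x+d+z]) ⟩
      ones (reps N) d x                                 ≡⟨ ones-reflect (reps N) (sum N) (λ u v → reps-complement N) x d 0 d+x+0≡ ⟩
      ones (reps N) 0 x                                 ∎
    where
    open ≡-Reasoning
    U : ℕ → ℕ
    U = reps (N ∷ʳ x)
    regroup : ∀ x d → x + d + x ≡ d + (x + x)
    regroup = solve-∀
    ΣNx< : sum (N ∷ʳ x) < x + d + x
    ΣNx< = ≤-reflexive (trans (cong suc (sum-∷ʳ N x)) (cong (_+ x) (sym x+d≡)))
    U[x+d+z] : ∀ {z} → U (x + d + z) ≡ reps N (d + z)
    U[x+d+z] {z} = begin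
      U (x + d + z)                                     ≡⟨ reps-∷ʳ N x (x + d + z) ⟩
      reps N (x + d + z) + shift (reps N) x (x + d + z) ≡⟨ cong₂ _+_ (reps-beyond N (≤-trans (≤-reflexive (sym x+d≡)) (m≤m+n _ z)))
                                                                   (trans (cong (shift (reps N) x) (+-assoc x d z)) (shift-+ (reps N) x (d + z))) ⟩
      reps N (d + z)                                    ∎
    d+x+0≡ : d + x + 0 ≡ suc (sum N)
    d+x+0≡ = trans (+-identityʳ _) (trans (+-comm d x) x+d≡)

  ones-reps-∷ʳ : ∀ {N x} → Complete N → x ≤ suc (sum N) →
                 ones (reps (N ∷ʳ x)) 0 (suc (sum (N ∷ʳ x))) ≡ branching (N ∷ʳ x) + branching (N ∷ʳ x)
  ones-reps-∷ʳ {N} {x} N-complete x≤1+ΣN with m≤n⇒∃[o]m+o≡n x≤1+ΣN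
  ... | g , x+g≡ =
    begin
      ones U 0 (suc (sum (N ∷ʳ x)))          ≡⟨ cong (λ s → ones U 0 (suc s)) (sum-∷ʳ N x) ⟩
      ones U 0 (suc (sum N) + x)             ≡⟨ cong (λ s → ones U 0 (s + x)) x+g≡ ⟨
      ones U 0 (x + g + x)                   ≡⟨ cong (ones U 0) (+-assoc x g x) ⟩
      ones U 0 (x + (g + x))                 ≡⟨ ones-++ U 0 x (g + x) ⟩
      ones U 0 x + ones U x (g + x)          ≡⟨ cong₂ _+_ (ones-reflect U (sum N + x) U-sym x 0 (suc (sum N)) (+-comm x (suc (sum N)))) upper ⟩
      ones U (suc (sum N)) x + ones U (suc (sum N)) x ≡⟨ cong₂ _+_ upper-branch upper-branch ⟨
      branching (N ∷ʳ x) + branching (N ∷ʳ x) ∎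
    where
    open ≡-Reasoning
    U : ℕ → ℕ
    U = reps (N ∷ʳ x)
    U-sym : ∀ u v → u + v ≡ sum N + x → U u ≡ U v
    U-sym u v u+v≡ = reps-complement (N ∷ʳ x) (trans u+v≡ (sym (sum-∷ʳ N x)))
    upper : ones U x (g + x) ≡ ones U (suc (sum N)) x
    upper = trans (ones-++ U x g x) (cong₂ _+_ (ones-reps-∷ʳ-gap {N} {x} N-complete x+g≡) (cong (λ a → ones U a x) x+g≡))
    upper-branch : branching (N ∷ʳ x) ≡ ones U (suc (sum N)) x
    upper-branch = begin
      branching (N ∷ʳ x)                          ≡⟨ cong₂ (λ a s → ones U a (suc s)) (lastOr-∷ʳ 0 N x) (sum-∷ʳ N x) ⟩
      ones U x (suc (sum N) + x)                  ≡⟨ cong (λ s → ones U x (s + x)) x+g≡ ⟨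
      ones U x (x + g + x)                        ≡⟨ cong (λ l → ones U x (l + x)) (+-comm x g) ⟩
      ones U x (g + x + x)                        ≡⟨ ones-++ U x (g + x) x ⟩
      ones U x (g + x) + ones U (x + (g + x)) x   ≡⟨ cong₂ _+_ upper (ones-reps-beyond (N ∷ʳ x) x ΣNx<) ⟩
      ones U (suc (sum N)) x + 0                  ≡⟨ +-identityʳ _ ⟩
      ones U (suc (sum N)) x                      ∎
      where
      ΣNx< : sum (N ∷ʳ x) < x + (g + x)
      ΣNx< = ≤-reflexive (trans (cong suc (sum-∷ʳ N x)) (trans (cong (_+ x) (sym x+g≡)) (+-assoc x g x)))

  slice : (ℕ → ℕ) → ℕ → ℕ → List ℕ
  slice e a zero    = []
  slice e a (suc l) = e a ∷ slice e (suc a) l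

  RepIn : (ℕ → ℕ) → ℕ → ℕ → List ℕ → ℕ → Set
  RepIn e a l S y = IsSubsetSumRep e S y × All (λ i → a ≤ i × i < a + l) S

  rep-narrow : ∀ {a l i} → a < i → i < a + suc l → suc a ≤ i × i < suc a + l
  rep-narrow {a} {l} a<i i<a+1+l = a<i , <-≤-trans i<a+1+l (≤-reflexive (+-suc a l))

  rep-widen : ∀ {a l i} → suc a ≤ i × i < suc a + l → a ≤ i × i < a + suc l
  rep-widen {a} {l} (a<i , i<) = <⇒≤ a<i , <-≤-trans i< (≤-reflexive (sym (+-suc a l)))

  rep-skip : ∀ {e a l S y} → RepIn e (suc a) l S y → RepIn e a (suc l) S y
  rep-skip (rep , bounds) = rep , All.map rep-widen bounds

  rep-use : ∀ {e a l T z} → RepIn e (suc a) l T z → RepIn e a (suc l) (a ∷ T) (e a + z)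
  rep-use {a = a} {l} ((ordered , ΣT≡z) , bounds) =
    (All.map proj₁ bounds ∷ ordered , cong (_ +_) ΣT≡z) ,
    (≤-refl , m<m+n a z<s) ∷ All.map rep-widen bounds

  data RepView (e : ℕ → ℕ) (a l y : ℕ) : List ℕ → Set where
    skip : ∀ {S} → RepIn e (suc a) l S y → RepView e a l y S
    use  : ∀ {T} → e a ≤ y → RepIn e (suc a) l T (y ∸ e a) → RepView e a l y (a ∷ T)

  repView : ∀ {e a l S y} → RepIn e a (suc l) S y → RepView e a l y S
  repView {S = []} (rep , []) = skip (rep , [])
  repView {e} {a} {S = i ∷ T} {y} ((i<T ∷ ordered , Σ≡y) , (a≤i , i<) ∷ bounds) with m≤n⇒m<n∨m≡n a≤i
  ... | inj₁ a<i  = skip ((i<T ∷ ordered , Σ≡y) ,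
                          rep-narrow a<i i< ∷ All.zipWith (λ (i<j , _ , j<) → rep-narrow (<-≤-trans a<i (<⇒≤ i<j)) j<) (i<T , bounds))
  ... | inj₂ refl = use (≤-trans (m≤m+n (e i) _) (≤-reflexive Σ≡y))
                        ((ordered , sym (trans (cong (_∸ e i) (sym Σ≡y)) (m+n∸m≡n (e i) _))) ,
                         All.zipWith (λ (i<j , _ , j<) → rep-narrow i<j j<) (i<T , bounds))

  rep-empty : ∀ {e a S y} → RepIn e a 0 S y → S ≡ [] × y ≡ 0
  rep-empty {S = []}                 ((_ , refl) , _) = refl , refl
  rep-empty {a = a} {i ∷ S} (_ , (a≤i , i<a+0) ∷ _)   =
    contradiction (≤-trans i<a+0 (≤-trans (≤-reflexive (+-identityʳ a)) a≤i)) (<-irrefl refl)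

  reps-slice-below : ∀ e a l {y} → y < e a → reps (slice e a (suc l)) y ≡ reps (slice e (suc a) l) y
  reps-slice-below e a l {y} y<ea = trans (cong (reps (slice e (suc a) l) y +_) (shift-< (reps (slice e (suc a) l)) y<ea)) (+-identityʳ _)

  reps-slice-above : ∀ e a l z →
    reps (slice e a (suc l)) (e a + z) ≡ reps (slice e (suc a) l) (e a + z) + reps (slice e (suc a) l) z
  reps-slice-above e a l z = cong (reps (slice e (suc a) l) (e a + z) +_) (shift-+ (reps (slice e (suc a) l)) (e a) z)

  rep⇒reps-pos : ∀ e a l {S y} → RepIn e a l S y → 1 ≤ reps (slice e a l) y
  rep⇒reps-pos e a zero    r with rep-empty r
  ... | refl , refl = ≤-refl
  rep⇒reps-pos e a (suc l) r with repView r
  ... | skip r′     = ≤-trans (rep⇒reps-pos e (suc a) l r′) (m≤m+n _ _)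
  ... | use ea≤y r′ = ≤-trans (rep⇒reps-pos e (suc a) l r′)
                              (≤-trans (≤-reflexive (sym (shift-≥ (reps (slice e (suc a) l)) ea≤y))) (m≤n+m _ _))

  reps-pos⇒rep : ∀ e a l {y} → 1 ≤ reps (slice e a l) y → ∃ λ S → RepIn e a l S y
  reps-pos⇒rep e a zero    {zero} _ = [] , ([] , refl) , []
  reps-pos⇒rep e a (suc l) {y} pos with 1 ≤? reps (slice e (suc a) l) y | offset (e a) y
  ... | yes pos′ | _ = let S , r = reps-pos⇒rep e (suc a) l pos′ in S , rep-skip r
  ... | no ¬pos′ | below y<ea =
    contradiction (subst (1 ≤_) (reps-slice-below e a l y<ea) pos) ¬pos′
  ... | no ¬pos′ | above z =
    let T , r = reps-pos⇒rep e (suc a) l (1≤+⇒1≤ʳ (subst (1 ≤_) (reps-slice-above e a l z) pos) ¬pos′)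
    in a ∷ T , rep-use r

  reps≥2⇒distinct : ∀ e a l {y} → 2 ≤ reps (slice e a l) y →
                    ∃ λ S₁ → ∃ λ S₂ → RepIn e a l S₁ y × RepIn e a l S₂ y × S₁ ≢ S₂
  reps≥2⇒distinct e a zero    {zero}  (s≤s ())
  reps≥2⇒distinct e a zero    {suc y} ()
  reps≥2⇒distinct e a (suc l) {y} two with 2 ≤? reps (slice e (suc a) l) y | offset (e a) y
  ... | yes two′ | _ =
    let S₁ , S₂ , r₁ , r₂ , S₁≢S₂ = reps≥2⇒distinct e (suc a) l two′ in S₁ , S₂ , rep-skip r₁ , rep-skip r₂ , S₁≢S₂
  ... | no ¬two′ | below y<ea =
    contradiction (subst (2 ≤_) (reps-slice-below e a l y<ea) two) ¬two′
  ... | no ¬two′ | above z with 2 ≤? reps (slice e (suc a) l) z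
  ...   | yes two″ =
    let T₁ , T₂ , r₁ , r₂ , T₁≢T₂ = reps≥2⇒distinct e (suc a) l two″
    in a ∷ T₁ , a ∷ T₂ , rep-use r₁ , rep-use r₂ , T₁≢T₂ ∘ ∷-injectiveʳ
  ...   | no ¬two″ =
    let pos₁ , pos₂ = 2≤+⇒1≤both (subst (2 ≤_) (reps-slice-above e a l z) two) ¬two′ ¬two″
        S , r₁ = reps-pos⇒rep e (suc a) l pos₁
        T , r₂ = reps-pos⇒rep e (suc a) l pos₂
    in S , a ∷ T , rep-skip r₁ , rep-use r₂ , skip≢use r₁
    where
    skip≢use : ∀ {S T y} → RepIn e (suc a) l S y → S ≢ a ∷ T
    skip≢use (_ , (a<a , _) ∷ _) refl = <-irrefl refl a<a

  rep-use⇒shift-pos : ∀ e a l {T y} → e a ≤ y → RepIn e (suc a) l T (y ∸ e a) → 1 ≤ shift (reps (slice e (suc a) l)) (e a) y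
  rep-use⇒shift-pos e a l ea≤y r = subst (1 ≤_) (sym (shift-≥ (reps (slice e (suc a) l)) ea≤y)) (rep⇒reps-pos e (suc a) l r)

  reps≡1⇒unique : ∀ e a l {y S₁ S₂} → reps (slice e a l) y ≡ 1 → RepIn e a l S₁ y → RepIn e a l S₂ y → S₁ ≡ S₂
  reps≡1⇒unique e a zero    _   r₁ r₂ = trans (proj₁ (rep-empty r₁)) (sym (proj₁ (rep-empty r₂)))
  reps≡1⇒unique e a (suc l) one r₁ r₂ with repView r₁ | repView r₂
  ... | skip r₁′     | skip r₂′     = reps≡1⇒unique e (suc a) l (+≡1⇒≡1ˡ one (rep⇒reps-pos e (suc a) l r₁′)) r₁′ r₂′
  ... | use ea≤y r₁′ | use _ r₂′    = cong (a ∷_) (reps≡1⇒unique e (suc a) l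
    (trans (sym (shift-≥ (reps (slice e (suc a) l)) ea≤y)) (+≡1⇒≡1ʳ one (rep-use⇒shift-pos e a l ea≤y r₁′))) r₁′ r₂′)
  ... | skip r₁′     | use ea≤y r₂′ =
    contradiction one (+≢1 (rep⇒reps-pos e (suc a) l r₁′) (rep-use⇒shift-pos e a l ea≤y r₂′))
  ... | use ea≤y r₁′ | skip r₂′     =
    contradiction one (+≢1 (rep⇒reps-pos e (suc a) l r₂′) (rep-use⇒shift-pos e a l ea≤y r₁′))

  Increasing : (ℕ → ℕ) → Set
  Increasing e = ∀ i → e i < e (suc i)

  increasing-≤ : ∀ {e} → Increasing e → e Preserves _≤_ ⟶ _≤_
  increasing-≤ {e} inc = suc-mono⇒mono e (<⇒≤ ∘ inc)

  -- Sequences ℕ → ℕ are 0-based: prefix e n = e 0 ∷ ⋯ ∷ e (n ∸ 1) ∷ [], while at is 1-based.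
  prefix : (ℕ → ℕ) → ℕ → List ℕ
  prefix e = slice e 0

  prefixSum : (ℕ → ℕ) → ℕ → ℕ
  prefixSum e n = sum (prefix e n)

  slice-suc : ∀ e a l → slice e a (suc l) ≡ slice e a l ∷ʳ e (a + l)
  slice-suc e a zero    = cong (λ i → e i ∷ []) (sym (+-identityʳ a))
  slice-suc e a (suc l) = cong (e a ∷_) (trans (slice-suc e (suc a) l) (cong (λ i → slice e (suc a) l ∷ʳ e i) (sym (+-suc a l))))

  prefix-suc : ∀ e n → prefix e (suc n) ≡ prefix e n ∷ʳ e n
  prefix-suc e = slice-suc e 0

  prefixSum-suc : ∀ e n → prefixSum e (suc n) ≡ prefixSum e n + e n
  prefixSum-suc e n = trans (cong sum (prefix-suc e n)) (sum-∷ʳ (prefix e n) (e n))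

  reps-prefix-suc : ∀ e n y → reps (prefix e (suc n)) y ≡ reps (prefix e n) y + shift (reps (prefix e n)) (e n) y
  reps-prefix-suc e n y = trans (cong (λ N → reps N y) (prefix-suc e n)) (reps-∷ʳ (prefix e n) (e n) y)

  lastOr-prefix : ∀ e n → lastOr 0 (prefix e (suc n)) ≡ e n
  lastOr-prefix e n = trans (cong (lastOr 0) (prefix-suc e n)) (lastOr-∷ʳ 0 (prefix e n) (e n))

  prefixSum-mono : ∀ e → prefixSum e Preserves _≤_ ⟶ _≤_
  prefixSum-mono e = suc-mono⇒mono (prefixSum e) λ n → ≤-trans (m≤m+n _ (e n)) (≤-reflexive (sym (prefixSum-suc e n)))

  reps-prefix-mono : ∀ e y → (λ n → reps (prefix e n) y) Preserves _≤_ ⟶ _≤_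
  reps-prefix-mono e y = suc-mono⇒mono _ λ n → ≤-trans (m≤m+n _ _) (≤-reflexive (sym (reps-prefix-suc e n y)))

  reps-prefix-stable : ∀ {e} → Increasing e → ∀ {i n y} → y < e i → i ≤ n → reps (prefix e n) y ≡ reps (prefix e i) y
  reps-prefix-stable {e} inc {i} {y = y} y<ei = suc-stable⇒stable (λ n → reps (prefix e n) y) λ n i≤n →
    trans (reps-prefix-suc e n y)
          (trans (cong (reps (prefix e n) y +_) (shift-< (reps (prefix e n)) (<-≤-trans y<ei (increasing-≤ {e} inc i≤n))))
                 (+-identityʳ _))

  slice-All : ∀ {P : ℕ → Set} {e} → (∀ i → P (e i)) → ∀ a l → All P (slice e a l)
  slice-All Pe a zero    = []
  slice-All Pe a (suc l) = Pe a ∷ slice-All Pe (suc a) l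

  prefixSum-≥ : ∀ {e} → (∀ i → 1 ≤ e i) → ∀ n → n ≤ prefixSum e n
  prefixSum-≥ {e} pos zero    = z≤n
  prefixSum-≥ {e} pos (suc n) = ≤-trans (≤-reflexive (+-comm 1 n))
                                        (≤-trans (+-mono-≤ (prefixSum-≥ pos n) (pos n)) (≤-reflexive (sym (prefixSum-suc e n))))

  applyUpTo≡prefix : ∀ e n → applyUpTo e n ≡ prefix e n
  applyUpTo≡prefix e zero    = refl
  applyUpTo≡prefix e (suc n) = trans (sym (applyUpTo-∷ʳ e n)) (trans (cong (_∷ʳ e n) (applyUpTo≡prefix e n)) (sym (prefix-suc e n)))

  prefix-cong : ∀ {f g} n → (∀ i → i < n → f i ≡ g i) → prefix f n ≡ prefix g n
  prefix-cong {f} {g} zero    _   = refl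
  prefix-cong {f} {g} (suc n) f≡g = begin
    prefix f (suc n)    ≡⟨ prefix-suc f n ⟩
    prefix f n ∷ʳ f n   ≡⟨ cong₂ _∷ʳ_ (prefix-cong n (λ i i<n → f≡g i (m<n⇒m<1+n i<n))) (f≡g n ≤-refl) ⟩
    prefix g n ∷ʳ g n   ≡⟨ prefix-suc g n ⟨
    prefix g (suc n)    ∎
    where open ≡-Reasoning

  take-prefix : ∀ e {i l} → i ≤ l → take i (prefix e l) ≡ prefix e i
  take-prefix e = take-slice 0
    where
    take-slice : ∀ a {i l} → i ≤ l → take i (slice e a l) ≡ slice e a i
    take-slice a {zero}              _         = refl
    take-slice a {suc i} {suc l} (s≤s i≤l) = cong (e a ∷_) (take-slice (suc a) i≤l)

  at-prefix : ∀ e {i l} → i < l → at (prefix e l) (suc i) ≡ e i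
  at-prefix e = at-slice 0
    where
    at-slice : ∀ a {i l} → i < l → at (slice e a l) (suc i) ≡ e (a + i)
    at-slice a {zero}  {suc l} _         = cong e (sym (+-identityʳ a))
    at-slice a {suc i} {suc l} (s≤s i<l) = trans (at-slice (suc a) i<l) (cong e (sym (+-suc a i)))

  prefixSum-+ : ∀ e j l → prefixSum e (j + l) ≡ prefixSum e j + sumFrom e j l
  prefixSum-+ e j zero    = trans (cong (prefixSum e) (+-identityʳ j)) (sym (+-identityʳ _))
  prefixSum-+ e j (suc l) = begin
    prefixSum e (j + suc l)                      ≡⟨ cong (prefixSum e) (+-suc j l) ⟩
    prefixSum e (suc (j + l))                    ≡⟨ prefixSum-suc e (j + l) ⟩
    prefixSum e (j + l) + e (j + l)              ≡⟨ cong (_+ e (j + l)) (prefixSum-+ e j l) ⟩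
    prefixSum e j + sumFrom e j l + e (j + l)    ≡⟨ +-assoc (prefixSum e j) _ _ ⟩
    prefixSum e j + (sumFrom e j l + e (j + l))  ≡⟨ cong (prefixSum e j +_) (sumFrom-suc e j l) ⟨
    prefixSum e j + sumFrom e j (suc l)          ∎
    where open ≡-Reasoning

  complete-prefix : ∀ {e} → (∀ i → e i ≤ suc (prefixSum e i)) → ∀ n → Complete (prefix e n)
  complete-prefix {e} growth zero    zero    _ = ≤-refl
  complete-prefix {e} growth (suc n) = subst Complete (sym (prefix-suc e n)) (complete-∷ʳ {prefix e n} (complete-prefix growth n) (growth n))

  ∈⇒≤sum : ∀ (e : ℕ → ℕ) S → All (λ i → e i ≤ sum (map e S)) S
  ∈⇒≤sum e []      = []
  ∈⇒≤sum e (i ∷ S) = m≤m+n (e i) _ ∷ All.map (λ ej≤ → ≤-trans ej≤ (m≤n+m (sum (map e S)) (e i))) (∈⇒≤sum e S)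

  rep-bounded : ∀ {e} → Increasing e → ∀ {n S y} → y < e n → IsSubsetSumRep e S y → RepIn e 0 n S y
  rep-bounded {e} inc {n} {S} y<en rep@(_ , ΣS≡y) = rep , All.map index-bound (∈⇒≤sum e S)
    where
    index-bound : ∀ {i} → e i ≤ sum (map e S) → 0 ≤ i × i < n
    index-bound {i} ei≤Σ with i <? n
    ... | yes i<n = z≤n , i<n
    ... | no  i≮n = contradiction (≤-<-trans (increasing-≤ inc (≮⇒≥ i≮n)) (≤-<-trans ei≤Σ (≤-<-trans (≤-reflexive ΣS≡y) y<en)))
                                  (<-irrefl refl)

  inR⇒reps-pos : ∀ {e} → Increasing e → ∀ {n y} → y < e n → InR e y → 1 ≤ reps (prefix e n) y
  inR⇒reps-pos {e} inc {n} y<en (_ , rep) = rep⇒reps-pos e 0 n (rep-bounded inc y<en rep)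

  reps-pos⇒inR : ∀ e n {y} → 1 ≤ reps (prefix e n) y → InR e y
  reps-pos⇒inR e n pos = let S , rep , _ = reps-pos⇒rep e 0 n pos in S , rep

  inUR⇒reps≡1 : ∀ {e} → Increasing e → ∀ {n y} → y < e n → InUR e y → reps (prefix e n) y ≡ 1
  inUR⇒reps≡1 {e} inc {n} {y} y<en (S , rep , unique) with 2 ≤? reps (prefix e n) y
  ... | yes two = let S₁ , S₂ , (rep₁ , _) , (rep₂ , _) , S₁≢S₂ = reps≥2⇒distinct e 0 n two
                  in contradiction (trans (unique S₁ rep₁) (sym (unique S₂ rep₂))) S₁≢S₂
  ... | no ¬two = ≤-antisym (≤-pred (≰⇒> ¬two)) (inR⇒reps-pos inc y<en (S , rep))

  reps≡1⇒inUR : ∀ {e} → Increasing e → ∀ {n y} → y < e n → reps (prefix e n) y ≡ 1 → InUR e y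
  reps≡1⇒inUR {e} inc {n} y<en one =
    let S , r@(rep , _) = reps-pos⇒rep e 0 n (≤-reflexive (sym one))
    in S , rep , λ S′ rep′ → reps≡1⇒unique e 0 n one (rep-bounded inc y<en rep′) r

  -- Infinite Meeussen sequences

  module InfiniteMeeussen {e : ℕ → ℕ} (e-meeussen : IsInfiniteMeeussen e) where

    increasing : Increasing e
    increasing = proj₁ (proj₂ e-meeussen)

    positive : ∀ i → 1 ≤ e i
    positive i = ≤-trans (≤-reflexive (sym (proj₁ e-meeussen))) (increasing-≤ increasing z≤n)

    pred-unique : ∀ i → reps (prefix e i) (e i ∸ 1) ≡ 1
    pred-unique i = inUR⇒reps≡1 increasing (∸1< (positive i)) (proj₂ (proj₂ (proj₂ e-meeussen)) i)

    growth : ∀ i → e i ≤ suc (prefixSum e i)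
    growth i with e i ≤? suc (prefixSum e i)
    ... | yes ei≤ = ei≤
    ... | no  ei≰ = contradiction (inR⇒reps-pos increasing (≰⇒> ei≰) (proj₁ (proj₂ (proj₂ e-meeussen)) _))
                                  (<-irrefl (sym (reps-beyond (prefix e i) ≤-refl)))

    complete : ∀ n → Complete (prefix e n)
    complete = complete-prefix growth

    gap : ∀ i → suc (suc (prefixSum e i)) ≤ e (suc i)
    gap i with suc (suc (prefixSum e i)) ≤? e (suc i)
    ... | yes gap≤ = gap≤
    ... | no  gap≰ = contradiction (trans (cong (λ N → reps N y) (sym (prefix-suc e i))) (pred-unique (suc i)))
                                   (>⇒≢ (reps-∷ʳ-≥2 {prefix e i} (complete i) ei≤y y≤Σ))
      where
      y : ℕ
      y = e (suc i) ∸ 1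
      y≤Σ : y ≤ prefixSum e i
      y≤Σ = m≤n+o⇒m∸n≤o (e (suc i)) 1 (≤-pred (≰⇒> gap≰))
      ei≤y : e i ≤ y
      ei≤y = m+n≤o⇒m≤o∸n (e i) (≤-trans (≤-reflexive (+-comm (e i) 1)) (increasing i))

    lastOr-prefix-< : ∀ n → lastOr 0 (prefix e n) < e n
    lastOr-prefix-< zero    = positive 0
    lastOr-prefix-< (suc n) = ≤-trans (s≤s (≤-reflexive (lastOr-prefix e n))) (increasing n)

    prefixSum-< : ∀ {j n} → j < n → prefixSum e j < prefixSum e n
    prefixSum-< {j} j<n = <-≤-trans (≤-<-trans (≤-reflexive (sym (+-identityʳ _))) (+-monoʳ-< (prefixSum e j) (positive j)))
                                    (≤-trans (≤-reflexive (sym (prefixSum-suc e j))) (prefixSum-mono e j<n))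

    branching-prefix : ∀ i → branching (prefix e (suc i)) ≡ ones (reps (prefix e i)) 0 (e i)
    branching-prefix i = trans (cong branching (prefix-suc e i)) (branching-∷ʳ {prefix e i} (complete i) (growth i))

    ones-reps-prefix : ∀ n → let N = prefix e (suc n) in ones (reps N) 0 (suc (sum N)) ≡ branching N + branching N
    ones-reps-prefix n = subst (λ N → ones (reps N) 0 (suc (sum N)) ≡ branching N + branching N) (sym (prefix-suc e n))
                               (ones-reps-∷ʳ {prefix e n} (complete n) (growth n))

    ones-reps-prefix-split : ∀ n {s x} → x + suc s ≡ prefixSum e (suc n) →
      let U = reps (prefix e (suc n)) in
      ones U 0 (suc x) + ones U 0 (suc s) ≡ branching (prefix e (suc n)) + branching (prefix e (suc n))
    ones-reps-prefix-split n {s} {x} x+1+s≡ = begin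
      ones U 0 (suc x) + ones U 0 (suc s)        ≡⟨ cong (ones U 0 (suc x) +_) (ones-reflect U (prefixSum e (suc n)) U-sym (suc s) 0 (suc x)
                                                                                      (trans (+-comm (suc s) (suc x)) (cong suc x+1+s≡))) ⟩
      ones U 0 (suc x) + ones U (suc x) (suc s)  ≡⟨ ones-++ U 0 (suc x) (suc s) ⟨
      ones U 0 (suc x + suc s)                   ≡⟨ cong (λ l → ones U 0 (suc l)) x+1+s≡ ⟩
      ones U 0 (suc (prefixSum e (suc n)))       ≡⟨ ones-reps-prefix n ⟩
      branching (prefix e (suc n)) + branching (prefix e (suc n)) ∎
      where
      open ≡-Reasoning
      U : ℕ → ℕ
      U = reps (prefix e (suc n))
      U-sym : ∀ u v → u + v ≡ prefixSum e (suc n) → U u ≡ U v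
      U-sym u v = reps-complement (prefix e (suc n))

    branching-prefix-earlier : ∀ {j n} → j < n → branching (prefix e (suc j)) ≡ ones (reps (prefix e n)) 0 (suc (prefixSum e j))
    branching-prefix-earlier {j} {n} j<n with m≤n⇒∃[o]m+o≡n (growth j)
    ... | g , ej+g≡ = begin
        branching (prefix e (suc j))          ≡⟨ branching-prefix j ⟩
        ones (reps (prefix e j)) 0 (e j)      ≡⟨ ones-cong _ U 0 0 (e j) (λ z z<ej → sym (reps-prefix-stable increasing z<ej (<⇒≤ j<n))) ⟩
        ones U 0 (e j)                        ≡⟨ +-identityʳ _ ⟨
        ones U 0 (e j) + 0                    ≡⟨ cong (ones U 0 (e j) +_) middle ⟨
        ones U 0 (e j) + ones U (e j) g       ≡⟨ ones-++ U 0 (e j) g ⟨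
        ones U 0 (e j + g)                    ≡⟨ cong (ones U 0) ej+g≡ ⟩
        ones U 0 (suc (prefixSum e j))        ∎
      where
      open ≡-Reasoning
      U : ℕ → ℕ
      U = reps (prefix e n)
      middle : ones U (e j) g ≡ 0
      middle = ones-none U (e j) g λ y ej≤y y<ej+g → >⇒≢ (≤-trans
        (subst (2 ≤_) (cong (λ N → reps N y) (sym (prefix-suc e j)))
               (reps-∷ʳ-≥2 {prefix e j} (complete j) ej≤y (≤-pred (<-≤-trans y<ej+g (≤-reflexive ej+g≡)))))
        (reps-prefix-mono e y j<n))

    reps-prefix-after-sum : ∀ {j n} → j < n → reps (prefix e n) (suc (prefixSum e j)) ≡ 1
    reps-prefix-after-sum {j} {n} j<n = begin
        reps (prefix e n) (suc Sj)                                       ≡⟨ reps-prefix-stable increasing (gap j) j<n ⟩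
        reps (prefix e (suc j)) (suc Sj)                                 ≡⟨ reps-prefix-suc e j (suc Sj) ⟩
        reps (prefix e j) (suc Sj) + shift (reps (prefix e j)) (e j) (suc Sj) ≡⟨ cong₂ _+_ (reps-beyond (prefix e j) ≤-refl)
                                                                                            (shift-≥ (reps (prefix e j)) (growth j)) ⟩
        reps (prefix e j) (suc Sj ∸ e j)                                 ≡⟨ reps-complement (prefix e j) (split (e j) (positive j) (growth j)) ⟩
        reps (prefix e j) (e j ∸ 1)                                      ≡⟨ pred-unique j ⟩
        1                                                                ∎
      where
      open ≡-Reasoning
      Sj : ℕ
      Sj = prefixSum e j
      split : ∀ x → 1 ≤ x → x ≤ suc Sj → (suc Sj ∸ x) + (x ∸ 1) ≡ Sj
      split (suc x) _ x<1+Sj = m∸n+n≡m (≤-pred x<1+Sj)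

    prefix-recurrence : ∀ {j n} → j < n →
      branching (prefix e (suc n)) + branching (prefix e (suc j)) ≡ branching (prefix e n) + branching (prefix e n) →
      e n + prefixSum e j ≡ prefixSum e n
    prefix-recurrence {j} {n@(suc n′)} j<n branching-difference
      with m≤n⇒∃[o]m+o≡n (prefixSum-< j<n) | m≤n⇒∃[o]m+o≡n (positive n)
    ... | x , 1+Sj+x≡Sn | p , 1+p≡en = begin
        e n + Sj        ≡⟨ cong (_+ Sj) (trans (sym 1+p≡en) (cong suc (sym x≡p))) ⟩
        suc x + Sj      ≡⟨ cong suc (+-comm x Sj) ⟩
        suc (Sj + x)    ≡⟨ 1+Sj+x≡Sn ⟩
        prefixSum e n   ∎
      where
      open ≡-Reasoning
      Sj : ℕ
      Sj = prefixSum e j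
      U : ℕ → ℕ
      U = reps (prefix e n)
      c : ℕ
      c = branching (prefix e n)
      x+1+Sj≡Sn : x + suc Sj ≡ prefixSum e n
      x+1+Sj≡Sn = trans (+-suc x Sj) (trans (cong suc (+-comm x Sj)) 1+Sj+x≡Sn)
      via-sum : ones U 0 (suc x) + ones U 0 (suc Sj) ≡ c + c
      via-sum = ones-reps-prefix-split n′ x+1+Sj≡Sn
      via-hypothesis : ones U 0 (e n) + ones U 0 (suc Sj) ≡ c + c
      via-hypothesis = trans (sym (cong₂ _+_ (branching-prefix n) (branching-prefix-earlier j<n))) branching-difference
      U[x]≡1 : U (0 + x) ≡ 1
      U[x]≡1 = trans (reps-complement (prefix e n) x+1+Sj≡Sn) (reps-prefix-after-sum j<n)
      U[p]≡1 : U (0 + p) ≡ 1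
      U[p]≡1 = trans (cong (λ y → U (y ∸ 1)) 1+p≡en) (pred-unique n)
      x≡p : x ≡ p
      x≡p = ones-injective U 0 U[x]≡1 U[p]≡1
              (+-cancelʳ-≡ _ _ _ (trans via-sum (trans (sym via-hypothesis) (cong (λ l → ones U 0 l + ones U 0 (suc Sj)) (sym 1+p≡en)))))

  -- Children in the Meeussen tree

  extend : (ℕ → ℕ) → ℕ → ℕ → ℕ → ℕ → ℕ
  extend m zero    x B zero    = x
  extend m zero    x B (suc j) = 2 ^ j * B
  extend m (suc L) x B zero    = m 0
  extend m (suc L) x B (suc i) = extend (m ∘ suc) L x B i

  extend-< : ∀ m L x B {i} → i < L → extend m L x B i ≡ m i
  extend-< m (suc L) x B {zero}  _         = refl
  extend-< m (suc L) x B {suc i} (s≤s i<L) = extend-< (m ∘ suc) L x B i<L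

  extend-≡ : ∀ m L x B → extend m L x B L ≡ x
  extend-≡ m zero    x B = refl
  extend-≡ m (suc L) x B = extend-≡ (m ∘ suc) L x B

  extend-> : ∀ m L x B j → extend m L x B (suc (L + j)) ≡ 2 ^ j * B
  extend-> m zero    x B j = refl
  extend-> m (suc L) x B j = extend-> (m ∘ suc) L x B j

  data Position (L : ℕ) : ℕ → Set where
    before : ∀ {i} → i < L → Position L i
    here   : Position L L
    after  : ∀ j → Position L (suc (L + j))

  position : ∀ L i → Position L i
  position L i with <-cmp i L
  ... | tri< i<L _ _ = before i<L
  ... | tri≈ _ refl _ = here
  ... | tri> _ _ L<i with m≤n⇒∃[o]m+o≡n L<i
  ...   | j , refl = after j

  -- After N ∷ʳ x every term is one more than the sum of all earlier ones: completeness is kept,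
  -- and each such term minus one is the sum of all earlier terms, uniquely as they are positive.
  module Extension {m} (m-meeussen : IsInfiniteMeeussen m) (L′ x : ℕ) (mL′<x : m L′ < x)
                   (x∸1-unique : reps (prefix m (suc L′)) (x ∸ 1) ≡ 1) where
    open InfiniteMeeussen m-meeussen

    L : ℕ
    L = suc L′

    B : ℕ
    B = suc (prefixSum m L + x)

    e : ℕ → ℕ
    e = extend m L x B

    prefix-e : ∀ {i} → i ≤ L → prefix e i ≡ prefix m i
    prefix-e {i} i≤L = prefix-cong i λ k k<i → extend-< m L x B (<-≤-trans k<i i≤L)

    prefixSum-e : ∀ {i} → i ≤ L → prefixSum e i ≡ prefixSum m i
    prefixSum-e i≤L = cong sum (prefix-e i≤L)

    x≤1+ΣL : x ≤ suc (prefixSum m L)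
    x≤1+ΣL with x ≤? suc (prefixSum m L)
    ... | yes x≤ = x≤
    ... | no  x≰ = contradiction (trans (sym (reps-beyond (prefix m L) ΣL<x∸1)) x∸1-unique) 0≢1+n
      where
      ΣL<x∸1 : prefixSum m L < x ∸ 1
      ΣL<x∸1 = m+n≤o⇒m≤o∸n (suc (prefixSum m L)) (≤-trans (≤-reflexive (+-comm _ 1)) (≰⇒> x≰))

    tail-e : ∀ j → e (suc (L + j)) ≡ suc (prefixSum e (suc (L + j)))
    tail-e j = trans (extend-> m L x B j) (sym (tail-sum j))
      where
      tail-sum : ∀ j → suc (prefixSum e (suc (L + j))) ≡ 2 ^ j * B
      tail-sum zero = begin
        suc (prefixSum e (suc (L + 0)))  ≡⟨ cong (λ i → suc (prefixSum e (suc i))) (+-identityʳ L) ⟩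
        suc (prefixSum e (suc L))        ≡⟨ cong suc (prefixSum-suc e L) ⟩
        suc (prefixSum e L + e L)        ≡⟨ cong₂ (λ s t → suc (s + t)) (prefixSum-e ≤-refl) (extend-≡ m L x B) ⟩
        B                                ≡⟨ +-identityʳ B ⟨
        2 ^ 0 * B                        ∎
        where open ≡-Reasoning
      tail-sum (suc j) = begin
        suc (prefixSum e (suc (L + suc j)))        ≡⟨ cong (λ i → suc (prefixSum e (suc i))) (+-suc L j) ⟩
        suc (prefixSum e (suc (suc (L + j))))      ≡⟨ cong suc (prefixSum-suc e (suc (L + j))) ⟩
        suc (prefixSum e (suc (L + j)) + e (suc (L + j))) ≡⟨ cong₂ _+_ (tail-sum j) (extend-> m L x B j) ⟩
        2 ^ j * B + 2 ^ j * B                      ≡⟨ double (2 ^ j) B ⟨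
        2 ^ suc j * B                              ∎
        where
        open ≡-Reasoning
        double : ∀ p B → (2 * p) * B ≡ p * B + p * B
        double = solve-∀

    positive-e : ∀ i → 1 ≤ e i
    positive-e i with position L i
    ... | before i<L = ≤-trans (positive i) (≤-reflexive (sym (extend-< m L x B i<L)))
    ... | here       = ≤-trans (≤-trans z<s mL′<x) (≤-reflexive (sym (extend-≡ m L x B)))
    ... | after j    = ≤-trans (s≤s z≤n) (≤-reflexive (sym (tail-e j)))

    e-after : ∀ {i} → L < i → e i ≡ suc (prefixSum e i)
    e-after L<i with m≤n⇒∃[o]m+o≡n L<i
    ... | j , refl = tail-e j

    increasing-from-L : ∀ {i} → L ≤ i → e i < e (suc i)
    increasing-from-L {i} L≤i = begin-strict
      e i                          <⟨ s≤s (m≤n+m (e i) _) ⟩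
      suc (prefixSum e i + e i)    ≡⟨ cong suc (prefixSum-suc e i) ⟨
      suc (prefixSum e (suc i))    ≡⟨ e-after (s≤s L≤i) ⟨
      e (suc i)                    ∎
      where open ≤-Reasoning

    increasing-e : Increasing e
    increasing-e i with position L i
    ... | before i<L with m≤n⇒m<n∨m≡n i<L
    ...   | inj₁ 1+i<L = ≤-trans (≤-trans (s≤s (≤-reflexive (extend-< m L x B i<L))) (increasing i))
                                 (≤-reflexive (sym (extend-< m L x B 1+i<L)))
    ...   | inj₂ refl  = ≤-trans (s≤s (≤-reflexive (extend-< m L x B i<L))) (≤-trans mL′<x (≤-reflexive (sym (extend-≡ m L x B))))
    increasing-e i | here    = increasing-from-L ≤-refl
    increasing-e i | after j = increasing-from-L (m≤n⇒m≤1+n (m≤m+n L j))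

    growth-e : ∀ i → e i ≤ suc (prefixSum e i)
    growth-e i with position L i
    ... | before i<L = subst₂ (λ a s → a ≤ suc s) (sym (extend-< m L x B i<L)) (sym (prefixSum-e (<⇒≤ i<L))) (growth i)
    ... | here       = subst₂ (λ a s → a ≤ suc s) (sym (extend-≡ m L x B)) (sym (prefixSum-e ≤-refl)) x≤1+ΣL
    ... | after j    = ≤-reflexive (tail-e j)

    pred-unique-e : ∀ i → reps (prefix e i) (e i ∸ 1) ≡ 1
    pred-unique-e i with position L i
    ... | before i<L = subst₂ (λ N a → reps N (a ∸ 1) ≡ 1) (sym (prefix-e (<⇒≤ i<L))) (sym (extend-< m L x B i<L)) (pred-unique i)
    ... | here       = subst₂ (λ N a → reps N (a ∸ 1) ≡ 1) (sym (prefix-e ≤-refl)) (sym (extend-≡ m L x B)) x∸1-unique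
    ... | after j    = trans (cong (λ a → reps (prefix e (suc (L + j))) (a ∸ 1)) (tail-e j)) (reps-sum (slice-All positive-e 0 (suc (L + j))))

    meeussen-e : IsInfiniteMeeussen e
    meeussen-e = proj₁ m-meeussen , increasing-e , all-in-r , λ i → reps≡1⇒inUR increasing-e {i} (∸1< (positive-e i)) (pred-unique-e i)
      where
      all-in-r : ∀ y → InR e y
      all-in-r y = reps-pos⇒inR e (suc y) (complete-prefix growth-e (suc y) y (≤-trans (n≤1+n y) (prefixSum-≥ positive-e (suc y))))

    prefix-e-suc : prefix e (suc L) ≡ prefix m L ∷ʳ x
    prefix-e-suc = trans (prefix-suc e L) (cong₂ _∷ʳ_ (prefix-e ≤-refl) (extend-≡ m L x B))

  meeussen-prefix : ∀ {N} → IsMeeussen N → ∃ λ m → IsInfiniteMeeussen m × N ≡ prefix m (length N)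
  meeussen-prefix (_ , m , m-meeussen , N≡) = m , m-meeussen , trans N≡ (applyUpTo≡prefix m _)

  meeussen-∷ʳ⁻ : ∀ {N x} → IsMeeussen (N ∷ʳ x) → lastOr 0 N < x × reps N (x ∸ 1) ≡ 1
  meeussen-∷ʳ⁻ {N} {x} Nx-meeussen with meeussen-prefix Nx-meeussen
  ... | m , m-meeussen , Nx≡ with ∷ʳ-injective N (prefix m (length N))
                                    (trans Nx≡ (trans (cong (prefix m) (length-∷ʳ N x)) (prefix-suc m (length N))))
  ...   | N≡ , x≡ = subst₂ (λ N′ x′ → lastOr 0 N′ < x′ × reps N′ (x′ ∸ 1) ≡ 1) (sym N≡) (sym x≡)
                           (lastOr-prefix-< (length N) , pred-unique (length N))
    where open InfiniteMeeussen m-meeussen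

  meeussen-∷ʳ⁺ : ∀ {N x} → IsMeeussen N → lastOr 0 N < x → reps N (x ∸ 1) ≡ 1 → IsMeeussen (N ∷ʳ x)
  meeussen-∷ʳ⁺ {N@(_ ∷ N′)} {x} N-meeussen last<x unique with meeussen-prefix N-meeussen
  ... | m , m-meeussen , N≡ =
    s≤s z≤n , Ext.e , Ext.meeussen-e ,
    trans (cong (_∷ʳ x) N≡) (trans (sym Ext.prefix-e-suc)
          (trans (sym (applyUpTo≡prefix Ext.e _)) (cong (applyUpTo Ext.e) (sym (length-∷ʳ N x)))))
    where
    mL′<x : m (length N′) < x
    mL′<x = subst (_< x) (trans (cong (lastOr 0) N≡) (lastOr-prefix m (length N′))) last<x
    unique′ : reps (prefix m (length N)) (x ∸ 1) ≡ 1
    unique′ = subst (λ N → reps N (x ∸ 1) ≡ 1) N≡ unique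
    module Ext = Extension m-meeussen (length N′) x mL′<x unique′

  tourChain-∷ʳ⁺ : ∀ {p} xs {w} → TourChain p xs → lastOr p xs < w → w ≤ 2 * lastOr p xs → TourChain p (xs ∷ʳ w)
  tourChain-∷ʳ⁺ []       []      lo hi = (lo , hi) ∷ []
  tourChain-∷ʳ⁺ (x ∷ xs) (b ∷ c) lo hi = b ∷ tourChain-∷ʳ⁺ xs c lo hi

  tourChain-∷ʳ⁻ : ∀ {p} xs {w} → TourChain p (xs ∷ʳ w) → lastOr p xs < w × w ≤ 2 * lastOr p xs
  tourChain-∷ʳ⁻ []       (b ∷ []) = b
  tourChain-∷ʳ⁻ (x ∷ xs) (_ ∷ c)  = tourChain-∷ʳ⁻ xs c

  tourChain-take : ∀ {p} i {xs} → TourChain p xs → TourChain p (take i xs)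
  tourChain-take zero    _       = []
  tourChain-take (suc i) []      = []
  tourChain-take (suc i) (b ∷ c) = b ∷ tourChain-take i c

  tournament-∷ʳ⁺ : ∀ xs {w} → IsTournament xs → lastOr 0 xs < w → w ≤ 2 * lastOr 0 xs → IsTournament (xs ∷ʳ w)
  tournament-∷ʳ⁺ (x ∷ xs) (x≡1 , c) lo hi = x≡1 , tourChain-∷ʳ⁺ xs c lo hi

  tournament-∷ʳ⁻ : ∀ xs {w} → IsTournament xs → IsTournament (xs ∷ʳ w) → lastOr 0 xs < w × w ≤ 2 * lastOr 0 xs
  tournament-∷ʳ⁻ (x ∷ xs) _ (_ , c) = tourChain-∷ʳ⁻ xs c

  tournament-take : ∀ i {xs} → IsTournament xs → IsTournament (take (suc i) xs)
  tournament-take i {x ∷ xs} (x≡1 , c) = x≡1 , tourChain-take i c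

  tournament-root : ∀ {xs} → IsTournament xs → take 1 xs ≡ 1 ∷ []
  tournament-root {x ∷ xs} (x≡1 , _) = cong (_∷ []) x≡1

  -- The recurrence

  ℤ-offset-cancel : ∀ {a b A B} (c : ℤ) → ℤ.+ a ≡ ℤ.+ A ℤ.+ c → ℤ.+ b ≡ ℤ.+ B ℤ.+ c → a + B ≡ b + A
  ℤ-offset-cancel {a} {b} {A} {B} c a≡ b≡ = ℤ.+-injective (begin
    ℤ.+ (a + B)                  ≡⟨ ℤ.pos-+ a B ⟩
    ℤ.+ a ℤ.+ ℤ.+ B              ≡⟨ cong (ℤ._+ ℤ.+ B) a≡ ⟩
    (ℤ.+ A ℤ.+ c) ℤ.+ ℤ.+ B      ≡⟨ ℤ.+-comm (ℤ.+ A ℤ.+ c) (ℤ.+ B) ⟩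
    ℤ.+ B ℤ.+ (ℤ.+ A ℤ.+ c)      ≡⟨ cong (ℤ._+_ (ℤ.+ B)) (ℤ.+-comm (ℤ.+ A) c) ⟩
    ℤ.+ B ℤ.+ (c ℤ.+ ℤ.+ A)      ≡⟨ ℤ.+-assoc (ℤ.+ B) c (ℤ.+ A) ⟨
    (ℤ.+ B ℤ.+ c) ℤ.+ ℤ.+ A      ≡⟨ cong (ℤ._+ ℤ.+ A) b≡ ⟨
    ℤ.+ b ℤ.+ ℤ.+ A              ≡⟨ ℤ.pos-+ b A ⟨
    ℤ.+ (b + A)                  ∎)
    where open ≡-Reasoning

  second-difference : ∀ (t : ℕ → ℕ) {n a k} (c : ℤ) → a + k ≡ n →
                      ℤ.+ t (suc n) ≡ ℤ.+ sumFrom t (suc a) k ℤ.+ c → ℤ.+ t n ≡ ℤ.+ sumFrom t a k ℤ.+ c →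
                      t (suc n) + t a ≡ t n + t n
  second-difference t {n} {a} {k} c a+k≡n t₊≡ t≡ = +-cancelʳ-≡ B _ _ (begin
    t (suc n) + t a + B       ≡⟨ swap (t (suc n)) (t a) B ⟩
    t (suc n) + B + t a       ≡⟨ cong (_+ t a) (ℤ-offset-cancel c t₊≡ t≡) ⟩
    t n + A + t a             ≡⟨ +-assoc (t n) A (t a) ⟩
    t n + (A + t a)           ≡⟨ cong (t n +_) (+-comm A (t a)) ⟩
    t n + sumFrom t a (suc k) ≡⟨ cong (t n +_) (trans (sumFrom-suc t a k) (cong (λ i → B + t i) a+k≡n)) ⟩
    t n + (B + t n)           ≡⟨ cong (t n +_) (+-comm B (t n)) ⟩
    t n + (t n + B)           ≡⟨ +-assoc (t n) (t n) B ⟨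
    t n + t n + B             ∎)
    where
    open ≡-Reasoning
    A B : ℕ
    A = sumFrom t (suc a) k
    B = sumFrom t a k
    swap : ∀ x y z → x + y + z ≡ x + z + y
    swap = solve-∀

  module TreeIsomorphism (φ : TSeq → MSeq) (iso : IsRootedTreeIso φ) where
    open IsRootedTreeIso iso

    branching-φ : ∀ s → branching (proj₁ (φ s)) ≡ lastOr 0 (proj₁ s)
    branching-φ s@(xs , xs-tournament) =
      trans (ones-cong (reps N) h ℓ (suc ℓ) (suc (sum N)) λ _ _ → refl)
            (ones-bijection h (suc ℓ) (suc (sum N)) F F-injective into onto)
      where
      N : List ℕ
      N = proj₁ (φ s)
      ℓ v : ℕ
      ℓ = lastOr 0 N
      v = lastOr 0 xs
      h : ℕ → ℕ
      h y = reps N (y ∸ 1)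
      child : Fin v → TSeq
      child w = xs ∷ʳ suc (v + toℕ w) , tournament-∷ʳ⁺ xs xs-tournament (s≤s (m≤m+n v _)) (m<n⇒n+m<2*n (Fin.toℕ<n w))
      φ-child : ∀ w → ∃ λ y → proj₁ (φ (child w)) ≡ N ∷ʳ y
      φ-child w = child→ s (child w) (_ , refl)
      F : Fin v → ℕ
      F w = proj₁ (φ-child w)
      into : ∀ w → suc ℓ ≤ F w × F w < suc ℓ + suc (sum N) × h (F w) ≡ 1
      into w with meeussen-∷ʳ⁻ (subst IsMeeussen (proj₂ (φ-child w)) (proj₂ (φ (child w))))
      ... | ℓ<Fw , hFw≡1 = ℓ<Fw , s≤s (≤-trans Fw≤1+ΣN (m≤n+m (suc (sum N)) ℓ)) , hFw≡1
        where
        Fw≤1+ΣN : F w ≤ suc (sum N)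
        Fw≤1+ΣN = ≤-trans (m≤n+m∸n (F w) 1) (s≤s (reps-pos⇒≤sum N (≤-reflexive (sym hFw≡1))))
      F-injective : Injective _≡_ _≡_ F
      F-injective {w} {w′} Fw≡Fw′ = Fin.toℕ-injective (+-cancelˡ-≡ v _ _ (suc-injective (∷ʳ-injectiveʳ xs xs
        (injective (child w) (child w′) (trans (proj₂ (φ-child w)) (trans (cong (N ∷ʳ_) Fw≡Fw′) (sym (proj₂ (φ-child w′)))))))))
      onto : ∀ y → suc ℓ ≤ y → y < suc ℓ + suc (sum N) → h y ≡ 1 → ∃ λ w → F w ≡ y
      onto y ℓ<y _ hy≡1 with surjective (N ∷ʳ y , meeussen-∷ʳ⁺ (proj₂ (φ s)) ℓ<y hy≡1)
      ... | s′ , φs′≡ with child← s s′ (y , φs′≡)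
      ...   | u , s′≡ with tournament-∷ʳ⁻ xs xs-tournament (subst IsTournament s′≡ (proj₂ s′))
      ...     | v<u , u≤2v with m≤n⇒∃[o]m+o≡n v<u
      ...       | w , 1+v+w≡u = fromℕ< w<v , ∷ʳ-injectiveʳ N N (trans (sym (proj₂ (φ-child (fromℕ< w<v))))
                                                              (trans (well-defined (child (fromℕ< w<v)) s′ same-child) φs′≡))
        where
        w<v : w < v
        w<v = n+m<2*n⇒m<n (subst (_≤ 2 * v) (sym 1+v+w≡u) u≤2v)
        same-child : xs ∷ʳ suc (v + toℕ (fromℕ< w<v)) ≡ proj₁ s′
        same-child = trans (cong (λ i → xs ∷ʳ suc (v + i)) (Fin.toℕ-fromℕ< w<v)) (trans (cong (xs ∷ʳ_) 1+v+w≡u) (sym s′≡))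

    module Truncations (ys : List ℕ) (ys-tournament : IsTournament ys) {n} (len : length ys ≡ suc n) where

      truncation : ℕ → TSeq
      truncation i = take (suc i) ys , tournament-take i ys-tournament

      φ-truncation-suc : ∀ {i} → i < n → ∃ λ y → proj₁ (φ (truncation (suc i))) ≡ proj₁ (φ (truncation i)) ∷ʳ y
      φ-truncation-suc {i} i<n = child→ (truncation i) (truncation (suc i))
                                   (at ys (suc (suc i)) , take-suc-at ys (<-≤-trans (s≤s i<n) (≤-reflexive (sym len))))

      length-φ-truncation : ∀ {i} → i ≤ n → length (proj₁ (φ (truncation i))) ≡ suc i
      length-φ-truncation {zero}  _   = cong length (root (truncation 0) (tournament-root ys-tournament))
      length-φ-truncation {suc i} i<n =
        let y , φ≡ = φ-truncation-suc i<n
        in trans (cong length φ≡) (trans (length-∷ʳ (proj₁ (φ (truncation i))) y) (cong suc (length-φ-truncation (<⇒≤ i<n))))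

      take-φ-truncation : ∀ {i j} → i ≤ j → j ≤ n → take (suc i) (proj₁ (φ (truncation j))) ≡ proj₁ (φ (truncation i))
      take-φ-truncation {i} {j} i≤j j≤n with m≤n⇒m<n∨m≡n i≤j
      ... | inj₂ refl = take-all (suc i) _ (≤-reflexive (length-φ-truncation j≤n))
      take-φ-truncation {i} {suc j} _ j<n | inj₁ (s≤s i≤j) =
        let y , φ≡ = φ-truncation-suc j<n
        in trans (cong (take (suc i)) φ≡)
                 (trans (take-∷ʳ _ y (≤-trans (s≤s i≤j) (≤-reflexive (sym (length-φ-truncation (<⇒≤ j<n))))))
                        (take-φ-truncation i≤j (<⇒≤ j<n)))

      φ≡φ-truncation : proj₁ (φ (ys , ys-tournament)) ≡ proj₁ (φ (truncation n))
      φ≡φ-truncation = well-defined _ (truncation n) (sym (take-all (suc n) ys (≤-reflexive len)))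

      length-φ : length (proj₁ (φ (ys , ys-tournament))) ≡ suc n
      length-φ = trans (cong length φ≡φ-truncation) (length-φ-truncation ≤-refl)

      branching-take-φ : ∀ {i} → i ≤ n → branching (take (suc i) (proj₁ (φ (ys , ys-tournament)))) ≡ at ys (suc i)
      branching-take-φ {i} i≤n = begin
        branching (take (suc i) (proj₁ (φ (ys , ys-tournament))))  ≡⟨ cong (λ M → branching (take (suc i) M)) φ≡φ-truncation ⟩
        branching (take (suc i) (proj₁ (φ (truncation n))))        ≡⟨ cong branching (take-φ-truncation i≤n ≤-refl) ⟩
        branching (proj₁ (φ (truncation i)))                        ≡⟨ branching-φ (truncation i) ⟩
        lastOr 0 (take (suc i) ys)                                  ≡⟨ lastOr-take ys (<-≤-trans (s≤s i≤n) (≤-reflexive (sym len))) ⟩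
        at ys (suc i)                                               ∎
        where open ≡-Reasoning

    recurrence-transfer : ∀ s {n a k} → length (proj₁ s) ≡ suc n → 1 ≤ a → a + k ≡ n →
                          at (proj₁ s) (suc n) + at (proj₁ s) a ≡ at (proj₁ s) n + at (proj₁ s) n →
                          at (proj₁ (φ s)) (suc n) ≡ sumFrom (at (proj₁ (φ s))) a (suc k)
    recurrence-transfer s@(ys , ys-tournament) {a = suc j} {k} len (s≤s z≤n) refl t-difference
      with meeussen-prefix (proj₂ (φ s))
    ... | m , m-meeussen , M≡ = begin
        at M (suc n)                    ≡⟨ cong (λ N → at N (suc n)) M≡prefix ⟩
        at (prefix m (suc n)) (suc n)   ≡⟨ at-prefix m ≤-refl ⟩
        m n                             ≡⟨ +-cancelˡ-≡ (prefixSum m j) _ _ (trans (+-comm (prefixSum m j) (m n)) (trans recurrence Sn≡)) ⟩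
        sumFrom m j (suc k)             ≡⟨ sumFrom-cong (at M) m (suc j) j (suc k) M-entries ⟨
        sumFrom (at M) (suc j) (suc k)  ∎
      where
      open ≡-Reasoning
      open Truncations ys ys-tournament len
      open InfiniteMeeussen m-meeussen
      n : ℕ
      n = suc (j + k)
      M : List ℕ
      M = proj₁ (φ s)
      M≡prefix : M ≡ prefix m (suc n)
      M≡prefix = trans M≡ (cong (prefix m) length-φ)
      t≡branching : ∀ {i} → i ≤ n → at ys (suc i) ≡ branching (prefix m (suc i))
      t≡branching {i} i≤n = trans (sym (branching-take-φ i≤n))
                                  (cong branching (trans (cong (take (suc i)) M≡prefix) (take-prefix m (s≤s i≤n))))
      recurrence : m n + prefixSum m j ≡ prefixSum m n
      recurrence = prefix-recurrence (s≤s (m≤m+n j k)) (begin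
        branching (prefix m (suc n)) + branching (prefix m (suc j))  ≡⟨ cong₂ _+_ (t≡branching ≤-refl)
                                                                                  (t≡branching (≤-trans (m≤m+n j k) (n≤1+n _))) ⟨
        at ys (suc n) + at ys (suc j)                                ≡⟨ t-difference ⟩
        at ys n + at ys n                                            ≡⟨ cong₂ _+_ (t≡branching (n≤1+n _)) (t≡branching (n≤1+n _)) ⟩
        branching (prefix m n) + branching (prefix m n)              ∎)
      Sn≡ : prefixSum m n ≡ prefixSum m j + sumFrom m j (suc k)
      Sn≡ = trans (cong (prefixSum m) (sym (+-suc j k))) (prefixSum-+ m j (suc k))
      M-entries : ∀ i → i < suc k → at M (suc j + i) ≡ m (j + i)
      M-entries i i<1+k = trans (cong (λ N → at N (suc (j + i))) M≡prefix)
                                (at-prefix m (s≤s (≤-trans (+-monoʳ-≤ j (≤-pred i<1+k)) (n≤1+n _))))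

open import Data.Nat using (ℕ; suc; _∸_; _≤_)
open import Data.Integer using (ℤ; +_; _+_)
open import Data.List using (length)
open import Data.Product using (proj₁)
open import Relation.Binary.PropositionalEquality using (_≡_)

proposition2 : (φ : TSeq → MSeq) → IsRootedTreeIso φ →
    (s : TSeq) (n k : ℕ) (c : ℤ) →
    length (proj₁ s) ≡ suc n → 1 ≤ k → 1 ≤ n ∸ k →
    + at (proj₁ s) (suc n) ≡ + sumFrom (at (proj₁ s)) (suc (n ∸ k)) k + c →
    + at (proj₁ s) n ≡ + sumFrom (at (proj₁ s)) (n ∸ k) k + c →
    at (proj₁ (φ s)) (suc n) ≡ sumFrom (at (proj₁ (φ s))) (n ∸ k) (suc k)
proposition2 φ iso s n k c len _ 1≤n∸k t₊≡ t≡ =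
  recurrence-transfer s len 1≤n∸k (m∸n>0⇒m∸n+n≡m n k 1≤n∸k)
    (second-difference (at (proj₁ s)) c (m∸n>0⇒m∸n+n≡m n k 1≤n∸k) t₊≡ t≡)
  where open TreeIsomorphism φ iso
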